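{- Let $s\ge 2$ be an integer, $r=s^{2}$, $a(n)=\lfloor n/s+s/2\rfloor$ for $n\in\mathbb{Z}$, and $S(n)=\sum_{j=0}^{r-1}a(n-j)$. For all integers $n\ge s^{2}$: (1) if $s$ is odd, then $S(n)=sn-s(s-1)/2$ and $a(S(n))=n$; (2) if $s$ is even, then $S(n)=sn-s(s-2)/2$ and $a(S(n))=n+1$. -}

module Defs where

open import Data.Nat as ℕ using (ℕ; NonZero)
open import Data.Integer as ℤ using (ℤ; +_)
open import Data.Rational as ℚ using (ℚ; floor)
open import Data.List using (List; foldr; map; upTo)

a : (s : ℕ) .{{_ : NonZero s}} → ℤ → ℤ
a s n = floor ((n ℚ./ s) ℚ.+ ((+ s) ℚ./ 2))

S : (s : ℕ) .{{_ : NonZero s}} → ℤ → ℤ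
S s n = foldr ℤ._+_ (+ 0) (map (λ j → a s (n ℤ.- + j)) (upTo (s ℕ.* s)))

module Submission where

-- Write a(n) = ⌊(2n + s²) / 2s⌋.  Then a(n + s) = a(n) + 1, so the sum W(x) of the s
-- consecutive values a(x), a(x − 1), …, a(x − s + 1) satisfies W(x + 1) = W(x) + 1, that is,
-- W(x) = x + β for a constant β.  Cutting the s² terms of S(n) into s blocks of length s gives
-- S(n) = Σ_{c<s} W(n − cs), an arithmetic progression, so 2 S(n) = s (2 W(n) − (s − 1) s).
-- The constant β is read off a window on which a is constant: a = t on [−t, t] when
-- s = 2t + 1, and a = s/2 on [0, s − 1] when s is even.  Knowing S(n) exactly, a(S(n)) is
-- found by dividing 2 S(n) + s² by 2s.

open import Defs
open import Data.Nat as ℕ using (ℕ; zero; suc; NonZero; _≤_; _/_; _∸_)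
import Data.Nat.Properties as ℕ
open import Data.Nat.DivMod using (m*n/n≡m)
open import Data.Nat.Divisibility using (_∣_; divides)
open import Data.Integer as ℤ using (ℤ; +_; -[1+_]; _+_; _-_; _*_; 0ℤ; 1ℤ)
import Data.Integer.Properties as ℤ
open import Data.Integer.DivMod using ([n/d]*d≤n; n<s[n/ℕd]*d; div-pos-is-/ℕ)
open import Data.Integer.Tactic.RingSolver using (solve-∀; solve)
open import Data.Rational as ℚ using (↥_; ↧_; toℚᵘ; floor)
open import Data.Rational.Properties using (toℚᵘ-homo-+; toℚᵘ-fromℚᵘ)
open import Data.Rational.Unnormalised using (mkℚᵘ; _≃_) renaming (↥_ to ↥ᵘ_; ↧_ to ↧ᵘ_)
open import Data.Rational.Unnormalised.Properties using (drop-*≡*; ≃-trans; +-cong)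
open import Data.List using ([]; _∷_; foldr; map; applyUpTo)
open import Data.Product using (_×_; _,_; ∃-syntax)
open import Data.Sum using (_⊎_; inj₁; inj₂)
open import Algebra.Properties.CommutativeSemigroup ℤ.*-commutativeSemigroup using (xy∙z≈xz∙y)
open import Function using (_∘_; id)
open import Relation.Nullary using (¬_; contradiction)
open import Relation.Binary.PropositionalEquality
  using (_≡_; refl; sym; trans; cong; cong₂; subst; module ≡-Reasoning)

infix 4 _≡⌊_÷_⌋

_≡⌊_÷_⌋ : ℤ → ℤ → ℤ → Set
k ≡⌊ x ÷ d ⌋ = k * d ℤ.≤ x × x ℤ.< ℤ.suc k * d

private instance
  pos⇒nonNeg : ∀ {i} .{{_ : ℤ.Positive i}} → ℤ.NonNegative i
  pos⇒nonNeg {i} = ℤ.nonNegative (ℤ.<⇒≤ (ℤ.positive⁻¹ i))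

module _ {d : ℤ} .{{_ : ℤ.Positive d}} where

  ⌊÷⌋-unique : ∀ {x k j} → k ≡⌊ x ÷ d ⌋ → j ≡⌊ x ÷ d ⌋ → k ≡ j
  ⌊÷⌋-unique {x} (kd≤x , x<[k+1]d) (jd≤x , x<[j+1]d) =
    ℤ.≤-antisym (below kd≤x x<[j+1]d) (below jd≤x x<[k+1]d)
    where
    below : ∀ {k j} → k * d ℤ.≤ x → x ℤ.< ℤ.suc j * d → k ℤ.≤ j
    below {k} {j} kd≤x x<[j+1]d =
      ℤ.≤-trans (ℤ.i<j⇒i≤pred[j] {k} {ℤ.suc j} (ℤ.*-cancelʳ-<-nonNeg d (ℤ.≤-<-trans kd≤x x<[j+1]d)))
                (ℤ.≤-reflexive (ℤ.pred-suc j))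

  ⌊÷⌋-intro : ∀ {x k r} → x ≡ k * d + r → 0ℤ ℤ.≤ r → r ℤ.< d → k ≡⌊ x ÷ d ⌋
  ⌊÷⌋-intro {k = k} {r} refl 0≤r r<d =
      subst (λ y → y ℤ.≤ k * d + r) (ℤ.+-identityʳ (k * d)) (ℤ.+-monoʳ-≤ (k * d) 0≤r)
    , subst (λ y → k * d + r ℤ.< y) (trans (ℤ.+-comm (k * d) d) (sym (ℤ.suc-* k d)))
            (ℤ.+-monoʳ-< (k * d) r<d)

  ⌊÷⌋-suc : ∀ {x k} → k ≡⌊ x ÷ d ⌋ → ℤ.suc k ≡⌊ (x + d) ÷ d ⌋
  ⌊÷⌋-suc {x} {k} (kd≤x , x<[k+1]d) =
      subst (λ y → y ℤ.≤ x + d) (sucd k) (ℤ.+-monoˡ-≤ d kd≤x)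
    , subst (λ y → x + d ℤ.< y) (sucd (ℤ.suc k)) (ℤ.+-monoˡ-< d x<[k+1]d)
    where
    sucd : ∀ k → k * d + d ≡ ℤ.suc k * d
    sucd k = trans (ℤ.+-comm (k * d) d) (sym (ℤ.suc-* k d))

  ⌊÷⌋-cross : ∀ {x e k y} .{{_ : ℤ.Positive e}} → x * e ≡ y * d → k ≡⌊ x ÷ d ⌋ → k ≡⌊ y ÷ e ⌋
  ⌊÷⌋-cross {x} {e} {k} {y} xe≡yd (kd≤x , x<[k+1]d) =
      ℤ.*-cancelʳ-≤-pos (k * e) y d (begin
        k * e * d        ≡⟨ xy∙z≈xz∙y k e d ⟩
        k * d * e        ≤⟨ ℤ.*-monoʳ-≤-nonNeg e kd≤x ⟩
        x * e            ≡⟨ xe≡yd ⟩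
        y * d            ∎)
    , ℤ.*-cancelʳ-<-nonNeg d (begin-strict
        y * d            ≡⟨ xe≡yd ⟨
        x * e            <⟨ ℤ.*-monoʳ-<-pos e x<[k+1]d ⟩
        ℤ.suc k * d * e  ≡⟨ xy∙z≈xz∙y (ℤ.suc k) d e ⟩
        ℤ.suc k * e * d  ∎)
    where open ℤ.≤-Reasoning

floor-≡⌊÷⌋ : ∀ p → floor p ≡⌊ ↥ p ÷ ↧ p ⌋
floor-≡⌊÷⌋ p@record{} =
    [n/d]*d≤n (↥ p) (↧ p)
  , subst (λ q → ↥ p ℤ.< ℤ.suc q * ↧ p) (sym (div-pos-is-/ℕ (↥ p) (ℚ.↧ₙ p)))
          (n<s[n/ℕd]*d (↥ p) (ℚ.↧ₙ p))

floor-≃ : ∀ {p q} → toℚᵘ p ≃ q → floor p ≡⌊ ↥ᵘ q ÷ ↧ᵘ q ⌋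
floor-≃ {p@record{}} {q@record{}} p≃q = ⌊÷⌋-cross {k = floor p} (drop-*≡* p≃q) (floor-≡⌊÷⌋ p)

a-≡⌊÷⌋ : ∀ s .{{_ : NonZero s}} n → a s n ≡⌊ (n * + 2 + + s * + s) ÷ (+ s * + 2) ⌋
a-≡⌊÷⌋ s@(suc s-1) n = floor-≃ (≃-trans (toℚᵘ-homo-+ (n ℚ./ s) (+ s ℚ./ 2))
                                         (+-cong (toℚᵘ-fromℚᵘ (mkℚᵘ n s-1)) (toℚᵘ-fromℚᵘ (mkℚᵘ (+ s) 1))))

a-unique : ∀ s .{{_ : NonZero s}} n {k} → k ≡⌊ (n * + 2 + + s * + s) ÷ (+ s * + 2) ⌋ → a s n ≡ k
a-unique s@(suc _) n = ⌊÷⌋-unique (a-≡⌊÷⌋ s n)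

a-+ : ∀ s .{{_ : NonZero s}} n → a s (n + + s) ≡ ℤ.suc (a s n)
a-+ s@(suc _) n =
  a-unique s (n + + s) (subst (λ x → ℤ.suc (a s n) ≡⌊ x ÷ + s * + 2 ⌋) (regroup n (+ s))
                               (⌊÷⌋-suc {k = a s n} (a-≡⌊÷⌋ s n)))
  where
  regroup : ∀ n σ → n * + 2 + σ * σ + σ * + 2 ≡ (n + σ) * + 2 + σ * σ
  regroup = solve-∀

∑ : ℕ → (ℕ → ℤ) → ℤ
∑ zero    f = 0ℤ
∑ (suc k) f = f 0 + ∑ k (f ∘ suc)

syntax ∑ k (λ i → x) = ∑[ i < k ] x

foldr-map-applyUpTo : ∀ {A : Set} (f : A → ℤ) g k →
                      foldr _+_ 0ℤ (map f (applyUpTo g k)) ≡ ∑[ i < k ] f (g i)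
foldr-map-applyUpTo f g zero    = refl
foldr-map-applyUpTo f g (suc k) = cong (_+_ (f (g 0))) (foldr-map-applyUpTo f (g ∘ suc) k)

∑-cong : ∀ {f g} k → (∀ i → f i ≡ g i) → ∑ k f ≡ ∑ k g
∑-cong zero    f≗g = refl
∑-cong (suc k) f≗g = cong₂ _+_ (f≗g 0) (∑-cong k (f≗g ∘ suc))

∑-const : ∀ {f c} k → (∀ {i} → i ℕ.< k → f i ≡ c) → ∑ k f ≡ + k * c
∑-const {c = c} zero    f≡c = sym (ℤ.*-zeroˡ c)
∑-const {c = c} (suc k) f≡c =
  trans (cong₂ _+_ (f≡c ℕ.z<s) (∑-const k (f≡c ∘ ℕ.s<s))) (sym (ℤ.suc-* (+ k) c))

∑-last : ∀ f k → ∑ (suc k) f ≡ ∑ k f + f k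
∑-last f zero    = ℤ.+-comm (f 0) 0ℤ
∑-last f (suc k) = trans (cong (_+_ (f 0)) (∑-last (f ∘ suc) k)) (sym (ℤ.+-assoc (f 0) _ _))

∑-+ : ∀ f m k → ∑ (m ℕ.+ k) f ≡ ∑ m f + ∑[ j < k ] f (m ℕ.+ j)
∑-+ f zero    k = sym (ℤ.+-identityˡ _)
∑-+ f (suc m) k = trans (cong (_+_ (f 0)) (∑-+ (f ∘ suc) m k)) (sym (ℤ.+-assoc (f 0) _ _))

∑-blocks : ∀ f s k → ∑ (k ℕ.* s) f ≡ ∑[ c < k ] ∑[ i < s ] f (c ℕ.* s ℕ.+ i)
∑-blocks f s zero    = refl
∑-blocks f s (suc k) = begin
  ∑ (s ℕ.+ k ℕ.* s) f
    ≡⟨ ∑-+ f s (k ℕ.* s) ⟩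
  ∑ s f + ∑[ j < k ℕ.* s ] f (s ℕ.+ j)
    ≡⟨ cong (_+_ (∑ s f)) (∑-blocks (λ j → f (s ℕ.+ j)) s k) ⟩
  ∑ s f + ∑[ c < k ] ∑[ i < s ] f (s ℕ.+ (c ℕ.* s ℕ.+ i))
    ≡⟨ cong (_+_ (∑ s f)) (∑-cong k λ c → ∑-cong s λ i → cong f (sym (ℕ.+-assoc s (c ℕ.* s) i))) ⟩
  ∑[ c < suc k ] ∑[ i < s ] f (c ℕ.* s ℕ.+ i) ∎
  where open ≡-Reasoning

∑-arithmetic : ∀ x d k → + 2 * ∑[ c < k ] (x - + c * d) ≡ + k * (+ 2 * x - (+ k - 1ℤ) * d)
∑-arithmetic x d zero    = refl
∑-arithmetic x d (suc k) = begin
  + 2 * (x - 0ℤ * d + ∑[ c < k ] (x - + suc c * d))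
    ≡⟨ cong (λ t → + 2 * (x - 0ℤ * d + t)) (∑-cong k λ c → shift-start x d (+ c)) ⟩
  + 2 * (x - 0ℤ * d + ∑[ c < k ] ((x - d) - + c * d))
    ≡⟨ ℤ.*-distribˡ-+ (+ 2) (x - 0ℤ * d) _ ⟩
  + 2 * (x - 0ℤ * d) + + 2 * ∑[ c < k ] ((x - d) - + c * d)
    ≡⟨ cong (_+_ (+ 2 * (x - 0ℤ * d))) (∑-arithmetic (x - d) d k) ⟩
  + 2 * (x - 0ℤ * d) + + k * (+ 2 * (x - d) - (+ k - 1ℤ) * d)
    ≡⟨ collect x d (+ k) ⟩
  + suc k * (+ 2 * x - (+ suc k - 1ℤ) * d) ∎
  where
  open ≡-Reasoning
  shift-start : ∀ x d c → x - (1ℤ + c) * d ≡ (x - d) - c * d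
  shift-start = solve-∀
  collect : ∀ x d k → + 2 * (x - 0ℤ * d) + k * (+ 2 * (x - d) - (k - 1ℤ) * d)
                      ≡ (1ℤ + k) * (+ 2 * x - (1ℤ + k - 1ℤ) * d)
  collect = solve-∀

module _ (g : ℤ → ℤ) (g-suc : ∀ x → g (ℤ.suc x) ≡ ℤ.suc (g x)) where

  private
    excess-suc : ∀ x → g (ℤ.suc x) - ℤ.suc x ≡ g x - x
    excess-suc x = trans (cong (_- ℤ.suc x) (g-suc x)) (cancel (g x) x)
      where
      cancel : ∀ y x → (1ℤ + y) - (1ℤ + x) ≡ y - x
      cancel = solve-∀

    excess-const : ∀ x → g x - x ≡ g 0ℤ - 0ℤ
    excess-const (+ zero)     = refl
    excess-const (+ suc n)    = trans (excess-suc (+ n)) (excess-const (+ n))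
    excess-const -[1+ zero ]  = sym (excess-suc -[1+ zero ])
    excess-const -[1+ suc n ] = trans (sym (excess-suc -[1+ suc n ])) (excess-const -[1+ n ])

  unit-slope : ∀ x y → g x ≡ g y + (x - y)
  unit-slope x y = begin
    g x            ≡⟨ restore (g x) x ⟩
    (g x - x) + x  ≡⟨ cong (_+ x) (trans (excess-const x) (sym (excess-const y))) ⟩
    (g y - y) + x  ≡⟨ regroup (g y) y x ⟩
    g y + (x - y)  ∎
    where
    open ≡-Reasoning
    restore : ∀ z x → z ≡ (z - x) + x
    restore = solve-∀
    regroup : ∀ z y x → (z - y) + x ≡ z + (x - y)
    regroup = solve-∀

window : ℕ → (ℤ → ℤ) → ℤ → ℤ
window s f x = ∑[ i < s ] f (x - + i)

window-suc : ∀ s .{{_ : NonZero s}} f → (∀ m → f (m + + s) ≡ ℤ.suc (f m)) →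
             ∀ x → window s f (ℤ.suc x) ≡ ℤ.suc (window s f x)
window-suc (suc s-1) f f-+ x = begin
  f (ℤ.suc x - 0ℤ) + ∑[ i < s-1 ] f (ℤ.suc x - + suc i)
    ≡⟨ cong₂ _+_ (cong f (wrap x (+ s-1))) (∑-cong s-1 λ i → cong f (unwrap x (+ i))) ⟩
  f ((x - + s-1) + + suc s-1) + window s-1 f x
    ≡⟨ cong (_+ window s-1 f x) (f-+ (x - + s-1)) ⟩
  ℤ.suc (f (x - + s-1)) + window s-1 f x
    ≡⟨ rotate (f (x - + s-1)) (window s-1 f x) ⟩
  ℤ.suc (window s-1 f x + f (x - + s-1))
    ≡⟨ cong ℤ.suc (∑-last (λ i → f (x - + i)) s-1) ⟨
  ℤ.suc (window (suc s-1) f x) ∎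
  where
  open ≡-Reasoning
  wrap : ∀ x k → (1ℤ + x) - 0ℤ ≡ (x - k) + (1ℤ + k)
  wrap = solve-∀
  unwrap : ∀ x i → (1ℤ + x) - (1ℤ + i) ≡ x - i
  unwrap = solve-∀
  rotate : ∀ y w → (1ℤ + y) + w ≡ 1ℤ + (w + y)
  rotate = solve-∀

sliding-sum : ∀ s .{{_ : NonZero s}} f → (∀ m → f (m + + s) ≡ ℤ.suc (f m)) →
              ∀ k n → + 2 * ∑[ j < k ℕ.* s ] f (n - + j) ≡ + k * (+ 2 * window s f n - (+ k - 1ℤ) * + s)
sliding-sum s f f-+ k n = begin
  + 2 * ∑[ j < k ℕ.* s ] f (n - + j)
    ≡⟨ cong (_*_ (+ 2)) (∑-blocks (λ j → f (n - + j)) s k) ⟩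
  + 2 * ∑[ c < k ] ∑[ i < s ] f (n - + (c ℕ.* s ℕ.+ i))
    ≡⟨ cong (_*_ (+ 2)) (∑-cong k λ c → trans (∑-cong s (cong f ∘ block-index c)) (block-window c)) ⟩
  + 2 * ∑[ c < k ] (window s f n - + c * + s)
    ≡⟨ ∑-arithmetic (window s f n) (+ s) k ⟩
  + k * (+ 2 * window s f n - (+ k - 1ℤ) * + s) ∎
  where
  open ≡-Reasoning
  block-index : ∀ c i → n - + (c ℕ.* s ℕ.+ i) ≡ (n - + c * + s) - + i
  block-index c i = begin
    n - + (c ℕ.* s ℕ.+ i)    ≡⟨ cong (λ j → n - j) (ℤ.pos-+ (c ℕ.* s) i) ⟩
    n - (+ (c ℕ.* s) + + i)  ≡⟨ cong (λ j → n - (j + + i)) (ℤ.pos-* c s) ⟩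
    n - (+ c * + s + + i)    ≡⟨ regroup n (+ c * + s) (+ i) ⟩
    (n - + c * + s) - + i    ∎
    where
    regroup : ∀ n m i → n - (m + i) ≡ (n - m) - i
    regroup = solve-∀
  block-window : ∀ c → window s f (n - + c * + s) ≡ window s f n - + c * + s
  block-window c = trans (unit-slope (window s f) (window-suc s f f-+) (n - + c * + s) n)
                         (cong (_+_ (window s f n)) (offset n (+ c * + s)))
    where
    offset : ∀ n m → (n - m) - n ≡ ℤ.- m
    offset = solve-∀

-- The remainder of 2b + s² modulo 2s is at least 2(s − 1), so lowering b by i < s
-- lowers it by 2i without leaving [0, 2s).
a-window : ∀ s .{{_ : NonZero s}} b c ε → ε ℕ.≤ 1 →
           b * + 2 + + s * + s ≡ c * (+ s * + 2) + ((+ s - 1ℤ) * + 2 + + ε) →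
           ∀ {i} → i ℕ.< s → a s (b - + i) ≡ c
a-window s@(suc s-1) b c ε ε≤1 X[b]≡ {i} (ℕ.s≤s i≤s-1) =
  a-unique s (b - + i) (⌊÷⌋-intro {k = c} X[b-i]≡ (ℤ.+≤+ ℕ.z≤n) (ℤ.+<+ (ℕ.s≤s remainder≤)))
  where
  open ≡-Reasoning
  d = s-1 ∸ i
  σ = + s
  D = + s * + 2
  X[b-i]≡ : (b - + i) * + 2 + σ * σ ≡ c * D + + (d ℕ.* 2 ℕ.+ ε)
  X[b-i]≡ = begin
    (b - + i) * + 2 + σ * σ
      ≡⟨ pull-out b σ (+ i) ⟩
    (b * + 2 + σ * σ) - + i * + 2
      ≡⟨ cong (_- + i * + 2) X[b]≡ ⟩
    c * D + (+ s-1 * + 2 + + ε) - + i * + 2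
      ≡⟨ cong (λ m → c * D + (m * + 2 + + ε) - + i * + 2)
              (trans (sym (ℤ.pos-+ i d)) (cong +_ (ℕ.m+[n∸m]≡n i≤s-1))) ⟨
    c * D + ((+ i + + d) * + 2 + + ε) - + i * + 2
      ≡⟨ cancel (c * D) (+ i) (+ d) (+ ε) ⟩
    c * D + (+ d * + 2 + + ε)
      ≡⟨ cong (λ r → c * D + (r + + ε)) (ℤ.pos-* d 2) ⟨
    c * D + (+ (d ℕ.* 2) + + ε)
      ≡⟨ cong (_+_ (c * D)) (ℤ.pos-+ (d ℕ.* 2) ε) ⟨
    c * D + + (d ℕ.* 2 ℕ.+ ε) ∎
    where
    pull-out : ∀ b σ i → (b - i) * + 2 + σ * σ ≡ (b * + 2 + σ * σ) - i * + 2
    pull-out = solve-∀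
    cancel : ∀ x i d e → x + ((i + d) * + 2 + e) - i * + 2 ≡ x + (d * + 2 + e)
    cancel = solve-∀
  remainder≤ : d ℕ.* 2 ℕ.+ ε ℕ.≤ suc (s-1 ℕ.* 2)
  remainder≤ = ℕ.≤-trans (ℕ.+-mono-≤ (ℕ.*-monoˡ-≤ 2 (ℕ.m∸n≤m s-1 i)) ε≤1)
                         (ℕ.≤-reflexive (ℕ.+-comm (s-1 ℕ.* 2) 1))

S-formula : ∀ s .{{_ : NonZero s}} n b c → (∀ {i} → i ℕ.< s → a s (b - + i) ≡ c) →
            + 2 * S s n ≡ + s * (+ 2 * (+ s * c + (n - b)) - (+ s - 1ℤ) * + s)
S-formula s n b c a≡c = begin
  + 2 * S s n
    ≡⟨ cong (_*_ (+ 2)) (foldr-map-applyUpTo (λ j → a s (n - + j)) id (s ℕ.* s)) ⟩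
  + 2 * ∑[ j < s ℕ.* s ] a s (n - + j)
    ≡⟨ sliding-sum s (a s) (a-+ s) s n ⟩
  + s * (+ 2 * window s (a s) n - (+ s - 1ℤ) * + s)
    ≡⟨ cong (λ w → + s * (+ 2 * w - (+ s - 1ℤ) * + s)) window≡ ⟩
  + s * (+ 2 * (+ s * c + (n - b)) - (+ s - 1ℤ) * + s) ∎
  where
  open ≡-Reasoning
  window≡ : window s (a s) n ≡ + s * c + (n - b)
  window≡ = trans (unit-slope (window s (a s)) (window-suc s (a s) (a-+ s)) n b)
                  (cong (_+ (n - b)) (∑-const s a≡c))

[m*[k*2]]/2≡m*k : ∀ m k → (m ℕ.* (k ℕ.* 2)) / 2 ≡ m ℕ.* k
[m*[k*2]]/2≡m*k m k = trans (cong (_/ 2) (sym (ℕ.*-assoc m k 2))) (m*n/n≡m (m ℕ.* k) 2)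

S-odd : ∀ t n → let s = suc (t ℕ.* 2) in
        S s n ≡ + s * n - + ((s ℕ.* (s ∸ 1)) / 2) × a s (S s n) ≡ n
S-odd t n =
    S≡
  , a-unique s (S s n) (⌊÷⌋-intro {k = n} (X[S]≡ (+ t) n σ≡ S≡σn-στ) (ℤ.+≤+ ℕ.z≤n)
                                  (ℤ.+<+ (ℕ.m<m*n s 2 ℕ.≤-refl)))
  where
  s = suc (t ℕ.* 2)
  σ≡ : + s ≡ 1ℤ + + t * + 2
  σ≡ = cong (_+_ 1ℤ) (ℤ.pos-* t 2)
  window-eq : ∀ {σ} τ → σ ≡ 1ℤ + τ * + 2 →
              τ * + 2 + σ * σ ≡ τ * (σ * + 2) + ((σ - 1ℤ) * + 2 + + 1)
  window-eq τ refl = solve (τ ∷ [])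
  closed-form : ∀ {σ} τ n S → σ ≡ 1ℤ + τ * + 2 →
                + 2 * S ≡ σ * (+ 2 * (σ * τ + (n - τ)) - (σ - 1ℤ) * σ) → S ≡ σ * n - σ * τ
  closed-form τ n S refl 2S≡ = ℤ.*-cancelˡ-≡ (+ 2) S _ (trans 2S≡ (solve (τ ∷ n ∷ [])))
  X[S]≡ : ∀ {σ S} τ n → σ ≡ 1ℤ + τ * + 2 → S ≡ σ * n - σ * τ →
          S * + 2 + σ * σ ≡ n * (σ * + 2) + σ
  X[S]≡ τ n refl refl = solve (τ ∷ n ∷ [])
  S≡σn-στ : S s n ≡ + s * n - + s * + t
  S≡σn-στ = closed-form (+ t) n (S s n) σ≡
              (S-formula s n (+ t) (+ t) (a-window s (+ t) (+ t) 1 ℕ.≤-refl (window-eq (+ t) σ≡)))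
  S≡ : S s n ≡ + s * n - + ((s ℕ.* (s ∸ 1)) / 2)
  S≡ = trans S≡σn-στ (cong (λ m → + s * n - m)
                           (trans (sym (ℤ.pos-* s t)) (cong +_ (sym ([m*[k*2]]/2≡m*k s t)))))

S-even : ∀ u n → let s = suc u ℕ.* 2 in
         S s n ≡ + s * n - + ((s ℕ.* (s ∸ 2)) / 2) × a s (S s n) ≡ n + + 1
S-even u n =
    S≡
  , a-unique s (S s n) (⌊÷⌋-intro {k = n + + 1} (X[S]≡ (+ u) n σ≡ S≡σn-συ) (ℤ.+≤+ ℕ.z≤n)
                                  (ℤ.+<+ ℕ.z<s))
  where
  s = suc u ℕ.* 2
  σ≡ : + s ≡ (1ℤ + + u) * + 2
  σ≡ = ℤ.pos-* (suc u) 2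
  window-eq : ∀ {σ} υ → σ ≡ (1ℤ + υ) * + 2 →
              (σ - 1ℤ) * + 2 + σ * σ ≡ (1ℤ + υ) * (σ * + 2) + ((σ - 1ℤ) * + 2 + + 0)
  window-eq υ refl = solve (υ ∷ [])
  closed-form : ∀ {σ} υ n S → σ ≡ (1ℤ + υ) * + 2 →
                + 2 * S ≡ σ * (+ 2 * (σ * (1ℤ + υ) + (n - (σ - 1ℤ))) - (σ - 1ℤ) * σ) →
                S ≡ σ * n - σ * υ
  closed-form υ n S refl 2S≡ = ℤ.*-cancelˡ-≡ (+ 2) S _ (trans 2S≡ (solve (υ ∷ n ∷ [])))
  X[S]≡ : ∀ {σ S} υ n → σ ≡ (1ℤ + υ) * + 2 → S ≡ σ * n - σ * υ →
          S * + 2 + σ * σ ≡ (n + + 1) * (σ * + 2) + + 0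
  X[S]≡ υ n refl refl = solve (υ ∷ n ∷ [])
  S≡σn-συ : S s n ≡ + s * n - + s * + u
  S≡σn-συ = closed-form (+ u) n (S s n) σ≡
              (S-formula s n (+ s - 1ℤ) (1ℤ + + u)
                (a-window s (+ s - 1ℤ) (1ℤ + + u) 0 ℕ.z≤n (window-eq (+ u) σ≡)))
  S≡ : S s n ≡ + s * n - + ((s ℕ.* (s ∸ 2)) / 2)
  S≡ = trans S≡σn-συ (cong (λ m → + s * n - m)
                           (trans (sym (ℤ.pos-* s u)) (cong +_ (sym ([m*[k*2]]/2≡m*k s u)))))

even-or-odd : ∀ n → (∃[ k ] n ≡ k ℕ.* 2) ⊎ (∃[ k ] n ≡ suc (k ℕ.* 2))
even-or-odd zero    = inj₁ (0 , refl)
even-or-odd (suc n) with even-or-odd n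
... | inj₁ (k , refl) = inj₂ (k , refl)
... | inj₂ (k , refl) = inj₁ (suc k , refl)

¬2∣1+k*2 : ∀ k → ¬ (2 ∣ suc (k ℕ.* 2))
¬2∣1+k*2 k (divides q 1+k*2≡q*2) =
  ℕ.even≢odd q k (trans (ℕ.*-comm 2 q) (trans (sym 1+k*2≡q*2) (cong suc (ℕ.*-comm k 2))))

theorem3p9 : (s : ℕ) .{{_ : NonZero s}} → 2 ≤ s → (n : ℤ) → + (s ℕ.* s) ℤ.≤ n →
    (¬ (2 ∣ s) → S s n ≡ + s ℤ.* n ℤ.- + ((s ℕ.* (s ∸ 1)) / 2) × a s (S s n) ≡ n)
    × (2 ∣ s → S s n ≡ + s ℤ.* n ℤ.- + ((s ℕ.* (s ∸ 2)) / 2) × a s (S s n) ≡ n ℤ.+ + 1)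
theorem3p9 s 2≤s n _ with even-or-odd s
... | inj₂ (t , refl)     = (λ _ → S-odd t n) , (λ 2∣s → contradiction 2∣s (¬2∣1+k*2 t))
... | inj₁ (suc u , refl) = (λ 2∤s → contradiction (divides (suc u) refl) 2∤s) , (λ _ → S-even u n)
... | inj₁ (zero , refl)  = contradiction 2≤s λ ()
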